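{- Let $a_2\ge 3$ and $b_2\ge 3$ be integers and let $F_3$ be a graph with at least $4$ vertices. Then $\{K_{1,a_2},\,K_1+K_{b_2},\,F_3\}$ is not a DSF set.
   Context: All graphs are finite and simple, considered up to isomorphism. $K_{1,a}$ is the star with $a$ leaves, $K_n$ the complete graph on $n$ vertices, and $G+H$ the disjoint union. For a set $\mathcal{F}$ of graphs, a graph is $\mathcal{F}$-free if none of its induced subgraphs is isomorphic to a member of $\mathcal{F}$. A set $\mathcal{F}$ of graphs is degree-sequence-forcing (DSF) if whenever some realization of a degree sequence $d$ (a graph with degree sequence $d$) is $\mathcal{F}$-free, every realization of $d$ is $\mathcal{F}$-free. -}

module Defs where

open import Data.Nat using (ℕ; zero; suc; _+_)
open import Data.Fin using (Fin; zero; suc; _≟_)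
open import Data.Bool using (Bool; true; false; if_then_else_; not)
open import Data.List using (List; []; _∷_; map; allFin)
open import Data.Nat.ListAction using (sum)
open import Data.List.Relation.Unary.All using (All)
open import Data.List.Relation.Binary.Permutation.Propositional using (_↭_)
open import Data.Product using (Σ; _,_; ∃; proj₁; proj₂)
open import Relation.Binary.PropositionalEquality using (_≡_)
open import Relation.Nullary using (¬_; does)
open import Function.Definitions using (Injective)

record Graph (n : ℕ) : Set where
  field
    adj    : Fin n → Fin n → Bool
    sym    : ∀ i j → adj i j ≡ adj j i
    irrefl : ∀ i → adj i i ≡ false
open Graph public

deg : ∀ {n} → Graph n → Fin n → ℕ
deg G i = sum (map (λ j → if adj G i j then 1 else 0) (allFin _))

degSeq : ∀ {n} → Graph n → List ℕ
degSeq {n} G = map (deg G) (allFin n)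

SameDegSeq : ∀ {n m} → Graph n → Graph m → Set
SameDegSeq G H = degSeq G ↭ degSeq H

HasInduced : ∀ {k n} → Graph k → Graph n → Set
HasInduced {k} {n} F G =
  Σ (Fin k → Fin n) λ f → Injective _≡_ _≡_ f × (∀ u v → adj F u v ≡ adj G (f u) (f v))
  where open import Data.Product using (_×_)

Family : Set
Family = List (Σ ℕ Graph)

Free : Family → ∀ {n} → Graph n → Set
Free ℱ G = All (λ F → ¬ HasInduced (proj₂ F) G) ℱ

DSF : Family → Set
DSF ℱ = ∀ {n m} (G : Graph n) (H : Graph m) → SameDegSeq G H → Free ℱ G → Free ℱ H

star : (a : ℕ) → Graph (suc a)
star a = record { adj = e ; sym = s ; irrefl = r }
  where
  e : Fin (suc a) → Fin (suc a) → Bool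
  e zero zero = false
  e zero (suc _) = true
  e (suc _) zero = true
  e (suc _) (suc _) = false
  s : ∀ i j → e i j ≡ e j i
  s zero zero = _≡_.refl
  s zero (suc _) = _≡_.refl
  s (suc _) zero = _≡_.refl
  s (suc _) (suc _) = _≡_.refl
  r : ∀ i → e i i ≡ false
  r zero = _≡_.refl
  r (suc _) = _≡_.refl

K1+K : (b : ℕ) → Graph (suc b)
K1+K b = record { adj = e ; sym = s ; irrefl = r }
  where
  open import Relation.Binary.PropositionalEquality using (refl; cong)
  e : Fin (suc b) → Fin (suc b) → Bool
  e zero _ = false
  e (suc _) zero = false
  e (suc i) (suc j) = not (does (i ≟ j))
  s : ∀ i j → e i j ≡ e j i
  s zero zero = refl
  s zero (suc _) = refl
  s (suc _) zero = refl
  s (suc i) (suc j) with i ≟ j | j ≟ i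
  ... | Relation.Nullary.yes _ | Relation.Nullary.yes _ = refl
  ... | Relation.Nullary.no _ | Relation.Nullary.no _ = refl
  ... | Relation.Nullary.yes p | Relation.Nullary.no q = Data.Empty.⊥-elim (q (Relation.Binary.PropositionalEquality.sym p))
    where import Data.Empty
  ... | Relation.Nullary.no p | Relation.Nullary.yes q = Data.Empty.⊥-elim (p (Relation.Binary.PropositionalEquality.sym q))
    where import Data.Empty
  r : ∀ i → e i i ≡ false
  r zero = refl
  r (suc i) with i ≟ i
  ... | Relation.Nullary.yes _ = refl
  ... | Relation.Nullary.no q = Data.Empty.⊥-elim (q refl)
    where import Data.Empty

module Submission where

-- If ℱ were DSF, then for every pair G, H of graphs with the
-- same degree sequence such that G avoids K_{1,a} and K_1 + K_b while H contains one of
-- them, G would have to contain F (lemma forced).  We exhibit several such pairs and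
-- compare the possible shapes (adjacency patterns) of four vertices of F inside each G:
--   * a ≤ b, 4 ≤ b:  blow-ups of two small graphs W and Z (a vertex replaced by
--     independent twins) and the co-crown of order a; no four-vertex shape occurs in
--     all three;
--   * a = b = 3:  the house Z, the co-crown of order 3, P₅ and C₄ + K₂.
-- Complementation swaps K_{1,a} and K_1 + K_a, so the case a > b follows (DSF-dual).

open import Defs
open import Data.Nat using (ℕ; _≤_)
open import Data.List using (_∷_; [])
open import Data.Product using (_,_)
open import Relation.Nullary using (¬_)

open import Data.Nat using (zero; suc; _+_; _*_; _∸_; _<_; z≤n; s≤s; _≡ᵇ_)
import Data.Nat.Properties as ℕₚ
open import Algebra.Properties.CommutativeSemigroup ℕₚ.+-commutativeSemigroup using (interchange)
open import Data.Bool using (Bool; true; false; if_then_else_; not; _∧_; _∨_)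
open import Data.Bool.Properties using (∨-comm; ∧-zeroʳ; not-injective) renaming (_≟_ to _≟ᵇ_)
open import Data.Fin using (Fin; zero; suc; fromℕ; inject₁; inject≤; toℕ; _↑ˡ_; _↑ʳ_; splitAt; join; _≟_)
open import Data.Fin.Patterns using (0F; 1F; 2F; 3F; 4F; 5F)
open import Data.Fin.Properties
  using (all?; pigeonhole; suc-injective; 0≢1+n; ↑ˡ-injective; ↑ʳ-injective; splitAt-↑ˡ; splitAt-↑ʳ;
         join-splitAt; inject≤-injective; <⇒≢)
open import Data.Vec using (Vec; []; _∷_; lookup)
open import Data.List using (List; foldr; tabulate; allFin; cartesianProduct; map; length)
open import Data.Bool.ListAction using (any)
open import Data.List.Properties using (map-tabulate; map-cong; map-∘; length-map; length-tabulate)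
open import Data.Nat.ListAction using (sum)
open import Data.List.Membership.Propositional using (_∈_)
open import Data.List.Membership.Propositional.Properties using (∈-allFin; ∈-cartesianProduct⁺)
open import Data.List.Relation.Unary.Any using (here; there)
open import Data.List.Relation.Unary.All using ([]; _∷_)
open import Data.List.Relation.Binary.Permutation.Propositional using (_↭_; ↭-reflexive)
open import Data.List.Relation.Binary.Permutation.Propositional.Properties using (↭-length; map⁺)
open import Data.Product using (_×_; proj₁; proj₂)
open import Data.Sum using (_⊎_; inj₁; inj₂; [_,_])
open import Data.Empty using (⊥; ⊥-elim)
open import Function using (_∘_; id)
open import Function.Definitions using (Injective)
open import Relation.Binary.PropositionalEquality
  using (_≡_; _≢_; refl; trans; cong; cong₂; subst; subst₂; module ≡-Reasoning)
  renaming (sym to ≡-sym)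
open import Relation.Nullary using (Dec; yes; no; does)
open import Relation.Nullary.Decidable using (from-yes; ¬?; _→-dec_; dec-true; dec-false)

open ≡-Reasoning

∧-elimˡ : ∀ {a b} → a ∧ b ≡ true → a ≡ true
∧-elimˡ {true} _ = refl

∧-elimʳ : ∀ {a b} → a ∧ b ≡ true → b ≡ true
∧-elimʳ {true} e = e

∨-false : ∀ {a b} → a ≡ false → b ≡ false → a ∨ b ≡ false
∨-false refl refl = refl

true≢false : true ≢ false
true≢false ()

two-valued : ∀ {a b c : Bool} → a ≢ c → b ≢ c → a ≡ b
two-valued {true}  {true}              _   _   = refl
two-valued {false} {false}             _   _   = refl
two-valued {true}  {false} {true}  a≢c _   = ⊥-elim (a≢c refl)
two-valued {true}  {false} {false} _   b≢c = ⊥-elim (b≢c refl)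
two-valued {false} {true}  {true}  _   b≢c = ⊥-elim (b≢c refl)
two-valued {false} {true}  {false} a≢c _   = ⊥-elim (a≢c refl)

does-sym : ∀ {n} (u v : Fin n) → does (u ≟ v) ≡ does (v ≟ u)
does-sym u v with u ≟ v
... | yes u≡v = ≡-sym (dec-true (v ≟ u) (≡-sym u≡v))
... | no  u≢v = ≡-sym (dec-false (v ≟ u) (u≢v ∘ ≡-sym))

does⇒≡ : ∀ {n} {u v : Fin n} → does (u ≟ v) ≡ true → u ≡ v
does⇒≡ {u = u} {v} d with u ≟ v
... | yes u≡v = u≡v

↑ˡ≢↑ʳ : ∀ m n (i : Fin m) (j : Fin n) → i ↑ˡ n ≢ m ↑ʳ j
↑ˡ≢↑ʳ (suc m) n zero    j ()
↑ˡ≢↑ʳ (suc m) n (suc i) j e = ↑ˡ≢↑ʳ m n i j (suc-injective e)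

splitAt-injective : ∀ m {n} (u v : Fin (m + n)) → splitAt m u ≡ splitAt m v → u ≡ v
splitAt-injective m {n} u v e =
  trans (≡-sym (join-splitAt m n u)) (trans (cong (join m n) e) (join-splitAt m n v))

injective? : ∀ {k n} (f : Fin k → Fin n) → Dec (∀ u v → f u ≡ f v → u ≡ v)
injective? f = all? λ u → all? λ v → (f u ≟ f v) →-dec (u ≟ v)

bit : Bool → ℕ
bit b = if b then 1 else 0

∑ : ∀ n → (Fin n → ℕ) → ℕ
∑ n f = sum (tabulate f)

∑-cong : ∀ n {f g : Fin n → ℕ} → (∀ i → f i ≡ g i) → ∑ n f ≡ ∑ n g
∑-cong zero    e = refl
∑-cong (suc n) e = cong₂ _+_ (e zero) (∑-cong n (e ∘ suc))

∑-const : ∀ n c {f : Fin n → ℕ} → (∀ i → f i ≡ c) → ∑ n f ≡ n * c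
∑-const zero    c e = refl
∑-const (suc n) c e = cong₂ _+_ (e zero) (∑-const n c (e ∘ suc))

∑-+ : ∀ n (f g : Fin n → ℕ) → ∑ n (λ i → f i + g i) ≡ ∑ n f + ∑ n g
∑-+ zero    f g = refl
∑-+ (suc n) f g = trans (cong (f zero + g zero +_) (∑-+ n (f ∘ suc) (g ∘ suc)))
                        (interchange (f zero) (g zero) _ _)

∑-split : ∀ m n (f : Fin (m + n) → ℕ) →
  ∑ (m + n) f ≡ ∑ m (λ i → f (i ↑ˡ n)) + ∑ n (λ j → f (m ↑ʳ j))
∑-split zero    n f = refl
∑-split (suc m) n f = trans (cong (f zero +_) (∑-split m n (f ∘ suc))) (≡-sym (ℕₚ.+-assoc (f zero) _ _))

∑-δ : ∀ n (u : Fin n) → ∑ n (λ v → bit (does (u ≟ v))) ≡ 1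
∑-δ (suc n) zero    = cong suc (trans (∑-const n 0 (λ _ → refl)) (ℕₚ.*-zeroʳ n))
∑-δ (suc n) (suc u) = ∑-δ n u

∑-not+bit : ∀ n (P : Fin n → Bool) → ∑ n (λ i → bit (not (P i))) + ∑ n (λ i → bit (P i)) ≡ n
∑-not+bit n P = begin
  ∑ n (λ i → bit (not (P i))) + ∑ n (λ i → bit (P i)) ≡⟨ ≡-sym (∑-+ n _ _) ⟩
  ∑ n (λ i → bit (not (P i)) + bit (P i))             ≡⟨ ∑-const n 1 (λ i → once (P i)) ⟩
  n * 1                                              ≡⟨ ℕₚ.*-identityʳ n ⟩
  n                                                  ∎
  where
  once : ∀ b → bit (not b) + bit b ≡ 1
  once true  = refl
  once false = refl

deg-∑ : ∀ {n} (G : Graph n) u → deg G u ≡ ∑ n (λ v → bit (adj G u v))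
deg-∑ G u = cong sum (map-tabulate id (λ v → bit (adj G u v)))

sameDegSeq-pointwise : ∀ {n} (G H : Graph n) → (∀ u → deg G u ≡ deg H u) → SameDegSeq G H
sameDegSeq-pointwise {n} G H e = ↭-reflexive (map-cong e (allFin n))

_≐_ : ∀ {n} → Graph n → Graph n → Set
G ≐ H = ∀ u v → adj G u v ≡ adj H u v

induced-respˡ : ∀ {k n} (X X′ : Graph k) (G : Graph n) → X ≐ X′ → HasInduced X G → HasInduced X′ G
induced-respˡ X X′ G X≐X′ (f , inj , pres) = f , inj , λ u v → trans (≡-sym (X≐X′ u v)) (pres u v)

induced-respʳ : ∀ {k n} (X : Graph k) (G G′ : Graph n) → G ≐ G′ → HasInduced X G → HasInduced X G′
induced-respʳ X G G′ G≐G′ (f , inj , pres) = f , inj , λ u v → trans (pres u v) (G≐G′ _ _)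

starAt : ∀ {n a} (G : Graph n) (c : Fin n) (leaf : Fin a → Fin n) → Injective _≡_ _≡_ leaf →
  (∀ i → adj G c (leaf i) ≡ true) → (∀ i j → adj G (leaf i) (leaf j) ≡ false) →
  HasInduced (star a) G
starAt {n} {a} G c leaf leaf-inj spoke independent = f , f-inj , pres
  where
  f : Fin (suc a) → Fin n
  f zero    = c
  f (suc i) = leaf i
  c≢leaf : ∀ i → c ≢ leaf i
  c≢leaf i c≡leaf =
    true≢false (trans (≡-sym (subst (λ x → adj G c x ≡ true) (≡-sym c≡leaf) (spoke i))) (irrefl G c))
  f-inj : Injective _≡_ _≡_ f
  f-inj {zero}  {zero}  _ = refl
  f-inj {zero}  {suc j} e = ⊥-elim (c≢leaf j e)
  f-inj {suc i} {zero}  e = ⊥-elim (c≢leaf i (≡-sym e))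
  f-inj {suc i} {suc j} e = cong suc (leaf-inj e)
  pres : ∀ u v → adj (star a) u v ≡ adj G (f u) (f v)
  pres zero    zero    = ≡-sym (irrefl G c)
  pres zero    (suc j) = ≡-sym (spoke j)
  pres (suc i) zero    = ≡-sym (trans (Graph.sym G (leaf i) c) (spoke i))
  pres (suc i) (suc j) = ≡-sym (independent i j)

preserves? : ∀ {k n} (X : Graph k) (G : Graph n) (f : Fin k → Fin n) →
  Dec (∀ u v → adj X u v ≡ adj G (f u) (f v))
preserves? X G f = all? λ u → all? λ v → adj X u v ≟ᵇ adj G (f u) (f v)

inducedVia : ∀ {k n} (X : Graph k) (G : Graph n) (f : Fin k → Fin n) →
  (∀ u v → f u ≡ f v → u ≡ v) → (∀ u v → adj X u v ≡ adj G (f u) (f v)) → HasInduced X G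
inducedVia X G f f-inj pres = f , (λ {u} {v} → f-inj u v) , pres

noStar-byColouring : ∀ {n k} (G : Graph n) a (col : Fin n → Fin n → Fin k) → k < a →
  (∀ c u v → adj G c u ≡ true → adj G c v ≡ true → adj G u v ≡ false → col c u ≡ col c v → u ≡ v) →
  ¬ HasInduced (star a) G
noStar-byColouring G a col k<a rainbow (f , f-inj , pres)
  with i , j , i<j , same ← pigeonhole k<a (λ i → col (f zero) (f (suc i))) =
  <⇒≢ i<j (suc-injective (f-inj (rainbow (f zero) (f (suc i)) (f (suc j))
    (≡-sym (pres zero (suc i))) (≡-sym (pres zero (suc j))) (≡-sym (pres (suc i) (suc j))) same)))

Proper : ∀ {n k} → Graph n → (Fin n → Fin k) → Set
Proper G col = ∀ p q → adj G p q ≡ true → col p ≢ col q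

proper? : ∀ {n k} (G : Graph n) (col : Fin n → Fin k) → Dec (Proper {n} {k} G col)
proper? G col = all? λ p → all? λ q → (adj G p q ≟ᵇ true) →-dec ¬? (col p ≟ col q)

-- A graph properly coloured with k < b colours has no K_b, hence no induced K_1 + K_b.
noK1+K-byColouring : ∀ {n k} (G : Graph n) b (col : Fin n → Fin k) → Proper G col → k < b →
  ¬ HasInduced (K1+K b) G
noK1+K-byColouring G b col proper k<b (f , f-inj , pres)
  with i , j , i<j , same ← pigeonhole k<b (col ∘ f ∘ suc) =
  proper (f (suc i)) (f (suc j)) (trans (≡-sym (pres (suc i) (suc j))) (cong not (dec-false (i ≟ j) (<⇒≢ i<j)))) same

-- Pullbacks and blow-ups.

pull : ∀ {k n} → Graph k → (Fin n → Fin k) → Graph n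
pull G φ = record
  { adj = λ u v → adj G (φ u) (φ v) ; sym = λ u v → Graph.sym G (φ u) (φ v) ; irrefl = λ u → irrefl G (φ u) }

collapse : ∀ k r → Fin (k + r) → Fin (suc k)
collapse zero    r v       = zero
collapse (suc k) r zero    = zero
collapse (suc k) r (suc v) = suc (collapse k r v)

-- The blow-up of G: its last vertex is replaced by r pairwise non-adjacent twins
-- (r = 0 deletes it).
blowup : ∀ {k} → Graph (suc k) → ∀ r → Graph (k + r)
blowup {k} G r = pull G (collapse k r)

collapse-↑ˡ : ∀ k r (i : Fin k) → collapse k r (i ↑ˡ r) ≡ inject₁ i
collapse-↑ˡ (suc k) r zero    = refl
collapse-↑ˡ (suc k) r (suc i) = cong suc (collapse-↑ˡ k r i)

collapse-↑ʳ : ∀ k r (j : Fin r) → collapse k r (k ↑ʳ j) ≡ fromℕ k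
collapse-↑ʳ zero    r j = refl
collapse-↑ʳ (suc k) r j = cong suc (collapse-↑ʳ k r j)

collapse-injective : ∀ k r (u v : Fin (k + r)) →
  collapse k r u ≡ collapse k r v → collapse k r u ≢ fromℕ k → u ≡ v
collapse-injective zero    r u       v       e ne = ⊥-elim (ne refl)
collapse-injective (suc k) r zero    zero    e ne = refl
collapse-injective (suc k) r (suc u) (suc v) e ne =
  cong suc (collapse-injective k r u v (suc-injective e) (ne ∘ cong suc))

data TwinView k r : Fin (k + r) → Set where
  twin : ∀ j → TwinView k r (k ↑ʳ j)
  base : ∀ {u} → collapse k r u ≢ fromℕ k → TwinView k r u

twinView : ∀ k r u → TwinView k r u
twinView zero    r u       = twin u
twinView (suc k) r zero    = base λ ()
twinView (suc k) r (suc u) with twinView k r u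
... | twin j  = twin j
... | base ne = base (ne ∘ suc-injective)

-- Summing h over the blow-up: the last vertex is counted r times instead of once.
∑-collapse : ∀ k r (h : Fin (suc k) → ℕ) →
  ∑ (k + r) (h ∘ collapse k r) + h (fromℕ k) ≡ ∑ (suc k) h + r * h (fromℕ k)
∑-collapse zero r h = begin
  ∑ r (λ _ → h zero) + h zero ≡⟨ cong (_+ h zero) (∑-const r (h zero) (λ _ → refl)) ⟩
  r * h zero + h zero         ≡⟨ ℕₚ.+-comm (r * h zero) (h zero) ⟩
  h zero + r * h zero         ≡⟨ cong (_+ r * h zero) (≡-sym (ℕₚ.+-identityʳ (h zero))) ⟩
  h zero + 0 + r * h zero     ∎
∑-collapse (suc k) r h = begin
  h zero + ∑ (k + r) (h ∘ suc ∘ collapse k r) + h (suc (fromℕ k))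
    ≡⟨ ℕₚ.+-assoc (h zero) _ _ ⟩
  h zero + (∑ (k + r) (h ∘ suc ∘ collapse k r) + h (suc (fromℕ k)))
    ≡⟨ cong (h zero +_) (∑-collapse k r (h ∘ suc)) ⟩
  h zero + (∑ (suc k) (h ∘ suc) + r * h (suc (fromℕ k)))
    ≡⟨ ≡-sym (ℕₚ.+-assoc (h zero) _ _) ⟩
  h zero + ∑ (suc k) (h ∘ suc) + r * h (suc (fromℕ k))
    ∎

deg-blowup : ∀ {k} (G : Graph (suc k)) r u → let p = collapse k r u ; x = bit (adj G p (fromℕ k)) in
  deg (blowup G r) u + x ≡ deg G p + r * x
deg-blowup {k} G r u = begin
  deg (blowup G r) u + h (fromℕ k)        ≡⟨ cong (_+ h (fromℕ k)) (deg-∑ (blowup G r) u) ⟩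
  ∑ (k + r) (h ∘ collapse k r) + h (fromℕ k) ≡⟨ ∑-collapse k r h ⟩
  ∑ (suc k) h + r * h (fromℕ k)           ≡⟨ cong (_+ r * h (fromℕ k)) (≡-sym (deg-∑ G (collapse k r u))) ⟩
  deg G (collapse k r u) + r * h (fromℕ k) ∎
  where
  h : Fin (suc k) → ℕ
  h p = bit (adj G (collapse k r u) p)

blowup-degrees : ∀ {k} (G H : Graph (suc k)) → (∀ p → adj G p (fromℕ k) ≡ adj H p (fromℕ k)) →
  (∀ p → deg G p ≡ deg H p) → ∀ r u → deg (blowup G r) u ≡ deg (blowup H r) u
blowup-degrees {k} G H same-last same-deg r u = ℕₚ.+-cancelʳ-≡ _ _ _ (begin
  deg (blowup G r) u + x ≡⟨ deg-blowup G r u ⟩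
  deg G p + r * x        ≡⟨ cong₂ (λ d z → d + r * z) (same-deg p) x≡y ⟩
  deg H p + r * y        ≡⟨ ≡-sym (deg-blowup H r u) ⟩
  deg (blowup H r) u + y ≡⟨ cong (deg (blowup H r) u +_) (≡-sym x≡y) ⟩
  deg (blowup H r) u + x ∎)
  where
  p = collapse k r u
  x = bit (adj G p (fromℕ k))
  y = bit (adj H p (fromℕ k))
  x≡y : x ≡ y
  x≡y = cong bit (same-last p)

Rainbow : ∀ {k s} → Graph (suc k) → (Fin (suc k) → Fin s) → Set
Rainbow {k} G col = ∀ c p q → p ≢ fromℕ k → q ≢ fromℕ k →
  adj G c p ≡ true → adj G c q ≡ true → adj G p q ≡ false → col p ≡ col q → p ≡ q

rainbow? : ∀ {k s} (G : Graph (suc k)) (col : Fin (suc k) → Fin s) → Dec (Rainbow {k} {s} G col)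
rainbow? {k} G col = all? λ c → all? λ p → all? λ q →
  ¬? (p ≟ fromℕ k) →-dec ¬? (q ≟ fromℕ k) →-dec (adj G c p ≟ᵇ true) →-dec (adj G c q ≟ᵇ true) →-dec
  (adj G p q ≟ᵇ false) →-dec (col p ≟ col q) →-dec (p ≟ q)

blowup-noStar : ∀ {k r s K} (G : Graph (suc k)) a (col : Fin (suc k) → Fin s) (emb : Fin s → Fin K)
  (cl : Fin r → Fin K) → K < a → Injective _≡_ _≡_ emb → Injective _≡_ _≡_ cl → Rainbow G col →
  (∀ c p j → p ≢ fromℕ k → adj G c p ≡ true → adj G c (fromℕ k) ≡ true → adj G p (fromℕ k) ≡ false →
     emb (col p) ≢ cl j) →
  ¬ HasInduced (star a) (blowup G r)
blowup-noStar {k} {r} G a col emb cl K<a emb-inj cl-inj rainbow apart =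
  noStar-byColouring (blowup G r) a (λ _ u → colour (twinView k r u)) K<a distinct
  where
  φ = collapse k r
  colour : ∀ {u} → TwinView k r u → Fin _
  colour (twin j) = cl j
  colour {u} (base _) = emb (col (φ u))
  twinLast : ∀ j → φ (k ↑ʳ j) ≡ fromℕ k
  twinLast = collapse-↑ʳ k r
  distinct : ∀ c u v → adj G (φ c) (φ u) ≡ true → adj G (φ c) (φ v) ≡ true → adj G (φ u) (φ v) ≡ false →
    colour (twinView k r u) ≡ colour (twinView k r v) → u ≡ v
  distinct c u v cu cv uv same with twinView k r u | twinView k r v
  ... | twin i  | twin j  = cong (k ↑ʳ_) (cl-inj same)
  ... | twin i  | base nv = ⊥-elim (apart (φ c) (φ v) i nv cv
          (subst (λ x → adj G (φ c) x ≡ true) (twinLast i) cu)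
          (trans (Graph.sym G (φ v) (fromℕ k)) (subst (λ x → adj G x (φ v) ≡ false) (twinLast i) uv)) (≡-sym same))
  ... | base nu | twin j  = ⊥-elim (apart (φ c) (φ u) j nu cu
          (subst (λ x → adj G (φ c) x ≡ true) (twinLast j) cv)
          (subst (λ x → adj G (φ u) x ≡ false) (twinLast j) uv) same)
  ... | base nu | base nv =
          collapse-injective k r u v (rainbow (φ c) (φ u) (φ v) nu nv cu cv uv (emb-inj same)) nu

-- A base vertex c adjacent to the last vertex, with s independent neighbours p i that
-- avoid the last vertex, spans K_{1,s+r} in the blow-up (the r twins are further leaves).
blowup-star : ∀ {k s} (G : Graph (suc k)) (c : Fin k) (p : Fin s → Fin k) → (∀ i j → p i ≡ p j → i ≡ j) →
  adj G (inject₁ c) (fromℕ k) ≡ true → (∀ i → adj G (inject₁ c) (inject₁ (p i)) ≡ true) →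
  (∀ i j → adj G (inject₁ (p i)) (inject₁ (p j)) ≡ false) →
  (∀ i → adj G (inject₁ (p i)) (fromℕ k) ≡ false) →
  ∀ r → HasInduced (star (s + r)) (blowup G r)
blowup-star {k} {s} G c p p-inj c-last c-p p-p p-last r =
  starAt (blowup G r) (c ↑ˡ r) (leaf ∘ splitAt s) leaf-inj
    (λ x → trans (cong₂ (adj G) (collapse-↑ˡ k r c) (image (splitAt s x))) (spoke (splitAt s x)))
    (λ x y → trans (cong₂ (adj G) (image (splitAt s x)) (image (splitAt s y)))
                   (independent (splitAt s x) (splitAt s y)))
  where
  leaf : Fin s ⊎ Fin r → Fin (k + r)
  leaf (inj₁ i) = p i ↑ˡ r
  leaf (inj₂ j) = k ↑ʳ j
  target : Fin s ⊎ Fin r → Fin (suc k)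
  target (inj₁ i) = inject₁ (p i)
  target (inj₂ j) = fromℕ k
  image : ∀ x → collapse k r (leaf x) ≡ target x
  image (inj₁ i) = collapse-↑ˡ k r (p i)
  image (inj₂ j) = collapse-↑ʳ k r j
  spoke : ∀ x → adj G (inject₁ c) (target x) ≡ true
  spoke (inj₁ i) = c-p i
  spoke (inj₂ j) = c-last
  independent : ∀ x y → adj G (target x) (target y) ≡ false
  independent (inj₁ i) (inj₁ j) = p-p i j
  independent (inj₁ i) (inj₂ j) = p-last i
  independent (inj₂ i) (inj₁ j) = trans (Graph.sym G (fromℕ k) _) (p-last j)
  independent (inj₂ i) (inj₂ j) = irrefl G (fromℕ k)
  leaf-injective : ∀ x y → leaf x ≡ leaf y → x ≡ y
  leaf-injective (inj₁ i) (inj₁ j) e = cong inj₁ (p-inj i j (↑ˡ-injective r (p i) (p j) e))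
  leaf-injective (inj₁ i) (inj₂ j) e = ⊥-elim (↑ˡ≢↑ʳ k r (p i) j e)
  leaf-injective (inj₂ i) (inj₁ j) e = ⊥-elim (↑ˡ≢↑ʳ k r (p j) i (≡-sym e))
  leaf-injective (inj₂ i) (inj₂ j) e = cong inj₂ (↑ʳ-injective k i j e)
  leaf-inj : Injective _≡_ _≡_ (leaf ∘ splitAt s)
  leaf-inj {x} {y} e = splitAt-injective s x y (leaf-injective _ _ e)

-- Four-vertex shapes, collected into tries by exhaustive enumeration.

Shape : Set
Shape = Vec Bool 6

shape : ∀ {V : Set} → (V → V → Bool) → (Fin 4 → V) → Shape
shape A t =
  A (t 0F) (t 1F) ∷ A (t 0F) (t 2F) ∷ A (t 0F) (t 3F) ∷ A (t 1F) (t 2F) ∷ A (t 1F) (t 3F) ∷ A (t 2F) (t 3F) ∷ []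

shape-cong : ∀ {V W : Set} {A : V → V → Bool} {B : W → W → Bool} {t t′} →
  (∀ i j → A (t i) (t j) ≡ B (t′ i) (t′ j)) → shape A t ≡ shape B t′
shape-cong e = cong₂ _∷_ (e 0F 1F) (cong₂ _∷_ (e 0F 2F) (cong₂ _∷_ (e 0F 3F)
               (cong₂ _∷_ (e 1F 2F) (cong₂ _∷_ (e 1F 3F) (cong₂ _∷_ (e 2F 3F) refl)))))

-- Finite sets of Boolean words of length n, as complete binary tries (left: next letter true).
data Trie : ℕ → Set where
  leaf : Bool → Trie zero
  node : ∀ {n} → Trie n → Trie n → Trie (suc n)

∅ : ∀ {n} → Trie n
∅ {zero}  = leaf false
∅ {suc n} = node ∅ ∅

insert : ∀ {n} → Vec Bool n → Trie n → Trie n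
insert []          (leaf _)   = leaf true
insert (true  ∷ s) (node t f) = node (insert s t) f
insert (false ∷ s) (node t f) = node t (insert s f)

member : ∀ {n} → Vec Bool n → Trie n → Bool
member []          (leaf b)   = b
member (true  ∷ s) (node t f) = member s t
member (false ∷ s) (node t f) = member s f

_∩_ : ∀ {n} → Trie n → Trie n → Trie n
leaf a   ∩ leaf b     = leaf (a ∧ b)
node t f ∩ node t′ f′ = node (t ∩ t′) (f ∩ f′)

-- Whether every member satisfies P; a single traversal, so each trie is computed once.
allMembers : ∀ {n} → (Vec Bool n → Bool) → Trie n → Bool
allMembers P (leaf b)   = not b ∨ P []
allMembers P (node t f) = allMembers (P ∘ (true ∷_)) t ∧ allMembers (P ∘ (false ∷_)) f

member-insert : ∀ {n} (s : Vec Bool n) T → member s (insert s T) ≡ true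
member-insert []          (leaf _)   = refl
member-insert (true  ∷ s) (node t f) = member-insert s t
member-insert (false ∷ s) (node t f) = member-insert s f

member-insert-mono : ∀ {n} (s s′ : Vec Bool n) T → member s T ≡ true → member s (insert s′ T) ≡ true
member-insert-mono []          []           (leaf _)   _ = refl
member-insert-mono (true  ∷ s) (true  ∷ s′) (node t f) m = member-insert-mono s s′ t m
member-insert-mono (true  ∷ s) (false ∷ s′) (node t f) m = m
member-insert-mono (false ∷ s) (true  ∷ s′) (node t f) m = m
member-insert-mono (false ∷ s) (false ∷ s′) (node t f) m = member-insert-mono s s′ f m

member-∩ : ∀ {n} (s : Vec Bool n) T T′ →
  member s T ≡ true → member s T′ ≡ true → member s (T ∩ T′) ≡ true
member-∩ []          (leaf _)   (leaf _)     refl refl = refl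
member-∩ (true  ∷ s) (node t f) (node t′ f′) m m′ = member-∩ s t t′ m m′
member-∩ (false ∷ s) (node t f) (node t′ f′) m m′ = member-∩ s f f′ m m′

allMembers-sound : ∀ {n} (P : Vec Bool n → Bool) s T → allMembers P T ≡ true → member s T ≡ true → P s ≡ true
allMembers-sound P []          (leaf true) e refl = e
allMembers-sound P (true  ∷ s) (node t f)  e m = allMembers-sound (P ∘ (true ∷_)) s t (∧-elimˡ e) m
allMembers-sound P (false ∷ s) (node t f)  e m =
  allMembers-sound (P ∘ (false ∷_)) s f (∧-elimʳ {allMembers (P ∘ (true ∷_)) t} e) m

collect : ∀ {A : Set} {n} → (A → Bool) → (A → Vec Bool n) → List A → Trie n
collect keep word = foldr (λ x T → if keep x then insert (word x) T else T) ∅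

collect-complete : ∀ {A : Set} {n} (keep : A → Bool) (word : A → Vec Bool n) {x xs} →
  x ∈ xs → keep x ≡ true → member (word x) (collect keep word xs) ≡ true
collect-complete keep word {x} (here refl) kept rewrite kept = member-insert (word x) _
collect-complete keep word {x} (there {x = y} {xs = ys} x∈ys) kept with keep y
... | true  = member-insert-mono (word x) (word y) _ (collect-complete keep word x∈ys kept)
... | false = collect-complete keep word x∈ys kept

Quad : Set → Set
Quad V = (V × V) × (V × V)

quadruples : ∀ k → List (Quad (Fin k))
quadruples k = cartesianProduct (cartesianProduct (allFin k) (allFin k)) (cartesianProduct (allFin k) (allFin k))

asFun : ∀ {V : Set} → Quad V → Fin 4 → V
asFun ((a , _) , (_ , _)) 0F = a
asFun ((_ , b) , (_ , _)) 1F = b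
asFun ((_ , _) , (c , _)) 2F = c
asFun ((_ , _) , (_ , d)) 3F = d

toQuad : ∀ {V : Set} → (Fin 4 → V) → Quad V
toQuad t = (t 0F , t 1F) , (t 2F , t 3F)

asFun-toQuad : ∀ {V : Set} (t : Fin 4 → V) i → asFun (toQuad t) i ≡ t i
asFun-toQuad t 0F = refl
asFun-toQuad t 1F = refl
asFun-toQuad t 2F = refl
asFun-toQuad t 3F = refl

toQuad∈ : ∀ {k} (t : Fin 4 → Fin k) → toQuad t ∈ quadruples k
toQuad∈ t = ∈-cartesianProduct⁺ (∈-cartesianProduct⁺ (∈-allFin _) (∈-allFin _))
                                 (∈-cartesianProduct⁺ (∈-allFin _) (∈-allFin _))

-- Four vertices may coincide only at marked vertices (which stand for classes of twins).
Admissible : ∀ {k} → (Fin k → Bool) → (Fin 4 → Fin k) → Set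
Admissible mark t = ∀ i j → i ≢ j → t i ≡ t j → mark (t i) ≡ true

admissible? : ∀ {k} (mark : Fin k → Bool) (t : Fin 4 → Fin k) → Dec (Admissible mark t)
admissible? mark t = all? λ i → all? λ j → ¬? (i ≟ j) →-dec (t i ≟ t j) →-dec (mark (t i) ≟ᵇ true)

admissibleQuad : ∀ {k} → (Fin k → Bool) → Quad (Fin k) → Bool
admissibleQuad mark q = does (admissible? mark (asFun q))

shapes : ∀ {k} → Graph k → (Fin k → Bool) → Trie 6
shapes {k} G mark = collect (admissibleQuad mark) (shape (adj G) ∘ asFun) (quadruples k)

shapes-complete : ∀ {k} (G : Graph k) mark (t : Fin 4 → Fin k) → Admissible mark t →
  member (shape (adj G) t) (shapes G mark) ≡ true
shapes-complete G mark t adm = collect-complete (admissibleQuad mark) (shape (adj G) ∘ asFun) (toQuad∈ t)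
  (dec-true (admissible? mark (asFun (toQuad t))) adm′)
  where
  adm′ : Admissible mark (asFun (toQuad t))
  adm′ i j i≢j same rewrite asFun-toQuad t i | asFun-toQuad t j = adm i j i≢j same

shape-pull : ∀ {k n m} (G : Graph k) (mark : Fin k → Bool) (φ : Fin n → Fin k) →
  (∀ u v → φ u ≡ φ v → mark (φ u) ≡ false → u ≡ v) → {X : Graph m} → HasInduced X (pull G φ) →
  (ι : Fin 4 → Fin m) → Injective _≡_ _≡_ ι → member (shape (adj X) ι) (shapes G mark) ≡ true
shape-pull G mark φ φ-inj {X} (e , e-inj , pres) ι ι-inj =
  subst (λ s → member s (shapes G mark) ≡ true)
    (≡-sym (shape-cong {A = adj X} {B = adj G} {t = ι} {t′ = φ ∘ e ∘ ι} λ i j → pres (ι i) (ι j)))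
    (shapes-complete G mark (φ ∘ e ∘ ι) admissible)
  where
  admissible : Admissible mark (φ ∘ e ∘ ι)
  admissible i j i≢j same with mark (φ (e (ι i))) in unmarked
  ... | true  = refl
  ... | false = ⊥-elim (i≢j (ι-inj (e-inj (φ-inj _ _ same unmarked))))

isLast : ∀ {k} → Fin (suc k) → Bool
isLast {k} p = does (p ≟ fromℕ k)

unmarked : ∀ {k} → Fin k → Bool
unmarked _ = false

shape-blowup : ∀ {k m} (G : Graph (suc k)) r {X : Graph m} → HasInduced X (blowup G r) →
  (ι : Fin 4 → Fin m) → Injective _≡_ _≡_ ι → member (shape (adj X) ι) (shapes G isLast) ≡ true
shape-blowup {k} G r {X} = shape-pull G isLast (collapse k r) injectiveOffLast {X}
  where
  injectiveOffLast : ∀ u v → collapse k r u ≡ collapse k r v → isLast (collapse k r u) ≡ false → u ≡ v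
  injectiveOffLast u v same notLast = collapse-injective k r u v same λ last →
    true≢false (trans (≡-sym (dec-true (collapse k r u ≟ fromℕ k) last)) notLast)

shape-plain : ∀ {k m} (G : Graph k) {X : Graph m} → HasInduced X G →
  (ι : Fin 4 → Fin m) → Injective _≡_ _≡_ ι → member (shape (adj X) ι) (shapes G unmarked) ≡ true
shape-plain G {X} = shape-pull G unmarked id (λ u v same _ → same) {X}

absent-blowup : ∀ {k} (G : Graph (suc k)) r (X : Graph 4) →
  member (shape (adj X) id) (shapes G isLast) ≡ false → ¬ HasInduced X (blowup G r)
absent-blowup G r X absent X⊑ = true≢false (trans (≡-sym (shape-blowup G r {X} X⊑ id id)) absent)

absent-plain : ∀ {k} (G : Graph k) (X : Graph 4) →
  member (shape (adj X) id) (shapes G unmarked) ≡ false → ¬ HasInduced X G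
absent-plain G X absent X⊑ = true≢false (trans (≡-sym (shape-plain G {X} X⊑ id id)) absent)

firstFour : ∀ {m} → 4 ≤ m → Fin 4 → Fin m
firstFour 4≤m i = inject≤ i 4≤m

firstFour-injective : ∀ {m} (4≤m : 4 ≤ m) → Injective _≡_ _≡_ (firstFour 4≤m)
firstFour-injective 4≤m {i} {j} = inject≤-injective 4≤m 4≤m i j

noneOf : Bool → Bool → Bool → Bool
noneOf x y z = not (x ∨ y ∨ z)

hasIndependentTriple : Shape → Bool
hasIndependentTriple (x01 ∷ x02 ∷ x03 ∷ x12 ∷ x13 ∷ x23 ∷ []) =
  noneOf x01 x02 x12 ∨ noneOf x01 x03 x13 ∨ noneOf x02 x03 x23 ∨ noneOf x12 x13 x23

noneOf-false : ∀ x y z → (x ≡ false → y ≡ false → z ≡ false → ⊥) → noneOf x y z ≡ false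
noneOf-false true  y     z     _ = refl
noneOf-false false true  z     _ = refl
noneOf-false false false true  _ = refl
noneOf-false false false false h = ⊥-elim (h refl refl refl)

-- Complementation.

comp : ∀ {n} → Graph n → Graph n
comp G = record
  { adj    = λ u v → not (adj G u v) ∧ not (does (u ≟ v))
  ; sym    = λ u v → cong₂ (λ x y → not x ∧ not y) (Graph.sym G u v) (does-sym u v)
  ; irrefl = λ u → trans (cong (λ y → not (adj G u u) ∧ not y) (dec-true (u ≟ u) refl)) (∧-zeroʳ _) }

comp-induced : ∀ {k n} (X : Graph k) (G : Graph n) → HasInduced X G → HasInduced (comp X) (comp G)
comp-induced X G (f , f-inj , pres) = f , f-inj , λ u v → cong₂ (λ x y → not x ∧ not y) (pres u v) (same-test u v)
  where
  same-test : ∀ u v → does (u ≟ v) ≡ does (f u ≟ f v)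
  same-test u v with u ≟ v
  ... | yes refl = ≡-sym (dec-true (f u ≟ f u) refl)
  ... | no  u≢v  = ≡-sym (dec-false (f u ≟ f v) (u≢v ∘ f-inj))

comp-comp : ∀ {n} (G : Graph n) → comp (comp G) ≐ G
comp-comp G u v with u ≟ v | adj G u v in uv
... | yes refl | _     = trans (∧-zeroʳ _) (≡-sym (trans (≡-sym uv) (irrefl G u)))
... | no _     | true  = refl
... | no _     | false = refl

comp-star : ∀ a → comp (star a) ≐ K1+K a
comp-star a zero    zero    = refl
comp-star a zero    (suc j) = refl
comp-star a (suc i) zero    = refl
comp-star a (suc i) (suc j) = refl

comp-K1+K : ∀ b → comp (K1+K b) ≐ star b
comp-K1+K b zero    zero    = refl
comp-K1+K b zero    (suc j) = refl
comp-K1+K b (suc i) zero    = refl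
comp-K1+K b (suc i) (suc j) with i ≟ j
... | yes _ = refl
... | no  _ = refl

induced-comp⁺ : ∀ {k n} (X : Graph k) (G : Graph n) → HasInduced (comp X) G → HasInduced X (comp G)
induced-comp⁺ X G X̄⊑G = induced-respˡ (comp (comp X)) X (comp G) (comp-comp X) (comp-induced (comp X) G X̄⊑G)

induced-comp⁻ : ∀ {k n} (X : Graph k) (G : Graph n) → HasInduced X (comp G) → HasInduced (comp X) G
induced-comp⁻ X G X⊑Ḡ = induced-respʳ (comp X) (comp (comp G)) G (comp-comp G) (comp-induced X (comp G) X⊑Ḡ)

-- Each other vertex is a neighbour either in G or in its complement.
deg-comp : ∀ {n} (G : Graph n) u → deg (comp G) u + deg G u + 1 ≡ n
deg-comp {n} G u = begin
  deg (comp G) u + deg G u + 1       ≡⟨ cong₂ (λ x y → x + y + 1) (deg-∑ (comp G) u) (deg-∑ G u) ⟩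
  ∑ n A + ∑ n B + 1                  ≡⟨ cong (∑ n A + ∑ n B +_) (≡-sym (∑-δ n u)) ⟩
  ∑ n A + ∑ n B + ∑ n D              ≡⟨ cong (_+ ∑ n D) (≡-sym (∑-+ n A B)) ⟩
  ∑ n (λ v → A v + B v) + ∑ n D      ≡⟨ ≡-sym (∑-+ n _ D) ⟩
  ∑ n (λ v → A v + B v + D v)        ≡⟨ ∑-const n 1 (λ v → exactlyOne (adj G u v) _ (loopless v)) ⟩
  n * 1                              ≡⟨ ℕₚ.*-identityʳ n ⟩
  n                                  ∎
  where
  A B D : Fin n → ℕ
  A v = bit (not (adj G u v) ∧ not (does (u ≟ v)))
  B v = bit (adj G u v)
  D v = bit (does (u ≟ v))
  loopless : ∀ v → does (u ≟ v) ≡ true → adj G u v ≡ false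
  loopless v _ with u ≟ v
  ... | yes refl = irrefl G u
  exactlyOne : ∀ x d → (d ≡ true → x ≡ false) → bit (not x ∧ not d) + bit x + bit d ≡ 1
  exactlyOne x     true  h rewrite h refl = refl
  exactlyOne true  false h = refl
  exactlyOne false false h = refl

degSeq-comp : ∀ {n} (G : Graph n) → degSeq (comp G) ≡ map (λ d → n ∸ suc d) (degSeq G)
degSeq-comp {n} G = trans (map-cong complement (allFin n)) (map-∘ (allFin n))
  where
  complement : ∀ u → deg (comp G) u ≡ n ∸ suc (deg G u)
  complement u = ≡-sym (begin
    n ∸ suc d           ≡⟨ cong (n ∸_) (ℕₚ.+-comm 1 d) ⟩
    n ∸ (d + 1)         ≡⟨ cong (_∸ (d + 1)) (≡-sym (deg-comp G u)) ⟩
    c + d + 1 ∸ (d + 1) ≡⟨ cong (_∸ (d + 1)) (ℕₚ.+-assoc c d 1) ⟩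
    c + (d + 1) ∸ (d + 1) ≡⟨ ℕₚ.m+n∸n≡m c (d + 1) ⟩
    c                   ∎)
    where
    c = deg (comp G) u
    d = deg G u

length-degSeq : ∀ {n} (G : Graph n) → length (degSeq G) ≡ n
length-degSeq {n} G = trans (length-map (deg G) (allFin n)) (length-tabulate id)

comp-sameDegSeq : ∀ {n m} (G : Graph n) (H : Graph m) →
  SameDegSeq G H → SameDegSeq (comp G) (comp H)
comp-sameDegSeq {n} G H same
  with trans (≡-sym (length-degSeq G)) (trans (↭-length same) (length-degSeq H))
... | refl = subst₂ _↭_ (≡-sym (degSeq-comp G)) (≡-sym (degSeq-comp H)) (map⁺ (λ d → n ∸ suc d) same)

Fam : ∀ a b {m} → Graph m → Family
Fam a b {m} F = (_ , star a) ∷ (_ , K1+K b) ∷ (m , F) ∷ []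

free-comp⁺ : ∀ {a b m n} (F : Graph m) (G : Graph n) → Free (Fam b a (comp F)) G → Free (Fam a b F) (comp G)
free-comp⁺ {a} {b} F G (noStar ∷ noK ∷ noF̄ ∷ []) =
    (λ star⊑ → noK (induced-respˡ (comp (star a)) (K1+K a) G (comp-star a) (induced-comp⁻ (star a) G star⊑)))
  ∷ (λ K⊑ → noStar (induced-respˡ (comp (K1+K b)) (star b) G (comp-K1+K b) (induced-comp⁻ (K1+K b) G K⊑)))
  ∷ (λ F⊑ → noF̄ (induced-comp⁻ F G F⊑))
  ∷ []

free-comp⁻ : ∀ {a b m n} (F : Graph m) (H : Graph n) → Free (Fam a b F) (comp H) → Free (Fam b a (comp F)) H
free-comp⁻ {a} {b} F H (noStar ∷ noK ∷ noF ∷ []) =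
    (λ star⊑ → noK (induced-respˡ (comp (star b)) (K1+K b) (comp H) (comp-star b) (comp-induced (star b) H star⊑)))
  ∷ (λ K⊑ → noStar (induced-respˡ (comp (K1+K a)) (star a) (comp H) (comp-K1+K a) (comp-induced (K1+K a) H K⊑)))
  ∷ (λ F̄⊑ → noF (induced-comp⁺ F H F̄⊑))
  ∷ []

DSF-dual : ∀ {a b m} (F : Graph m) → DSF (Fam a b F) → DSF (Fam b a (comp F))
DSF-dual F dsf G H same free =
  free-comp⁻ F H (dsf (comp G) (comp H) (comp-sameDegSeq G H same) (free-comp⁺ F G free))

-- The small graphs, given by edge lists; their properties are checked by computation.

hasEdge : List (ℕ × ℕ) → ℕ → ℕ → Bool
hasEdge E x y = any (λ e → (proj₁ e ≡ᵇ x) ∧ (proj₂ e ≡ᵇ y)) E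

fromEdges : ∀ n → List (ℕ × ℕ) → Graph n
fromEdges n E = record
  { adj    = λ u v → edge u v ∧ not (does (u ≟ v))
  ; sym    = λ u v → cong₂ (λ x y → x ∧ not y) (∨-comm (hasEdge E (toℕ u) (toℕ v)) _) (does-sym u v)
  ; irrefl = λ u → trans (cong (λ y → edge u u ∧ not y) (dec-true (u ≟ u) refl)) (∧-zeroʳ (edge u u)) }
  where
  edge : Fin n → Fin n → Bool
  edge u v = hasEdge E (toℕ u) (toℕ v) ∨ hasEdge E (toℕ v) (toℕ u)

-- W = K_{1,1,1} + K₂ (hubs 0, 1, edge 23, and vertex 4 to be blown up); Ŵ is obtained by
-- the degree-preserving 2-switch 01, 23 ↦ 02, 13.  Blowing 4 up into a - 1 twins,
-- W avoids K_{1,a} while Ŵ contains it.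
W Ŵ : Graph 5
W = fromEdges 5 ((0 , 1) ∷ (2 , 3) ∷ (0 , 4) ∷ (1 , 4) ∷ [])
Ŵ = fromEdges 5 ((0 , 2) ∷ (1 , 3) ∷ (0 , 4) ∷ (1 , 4) ∷ [])

W-sameDegSeq : ∀ r → SameDegSeq (blowup W r) (blowup Ŵ r)
W-sameDegSeq r = sameDegSeq-pointwise (blowup W r) (blowup Ŵ r) (blowup-degrees W Ŵ
  (from-yes (all? λ p → adj W p 4F ≟ᵇ adj Ŵ p 4F)) (from-yes (all? λ p → deg W p ℕₚ.≟ deg Ŵ p)) r)

W-absorbs : ∀ c p → p ≢ 4F → adj W c p ≡ true → adj W c 4F ≡ true → adj W p 4F ≡ true
W-absorbs = from-yes (all? λ c → all? λ p →
  ¬? (p ≟ 4F) →-dec (adj W c p ≟ᵇ true) →-dec (adj W c 4F ≟ᵇ true) →-dec (adj W p 4F ≟ᵇ true))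

W-noStar : ∀ r → ¬ HasInduced (star (3 + r)) (blowup W (2 + r))
W-noStar r = blowup-noStar W (3 + r) (λ _ → 0F) (λ _ → zero) id (ℕₚ.n<1+n _) oneColour id
  (from-yes (rainbow? W (λ _ → 0F)))
  (λ c p j p≢4 cp c4 p4 _ → true≢false (trans (≡-sym (W-absorbs c p p≢4 cp c4)) p4))
  where
  oneColour : Injective _≡_ _≡_ (λ (_ : Fin 1) → zero {1 + r})
  oneColour {zero} {zero} _ = refl

W-colouring : Fin 5 → Fin 3
W-colouring = lookup (0F ∷ 1F ∷ 0F ∷ 1F ∷ 2F ∷ [])

W-noK1+K : ∀ r b → 4 ≤ b → ¬ HasInduced (K1+K b) (blowup W r)
W-noK1+K r b 4≤b = noK1+K-byColouring (blowup W r) b (W-colouring ∘ collapse 4 r)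
  (λ p q → from-yes (proper? W W-colouring) (collapse 4 r p) (collapse 4 r q)) 4≤b

Ŵ-star : ∀ r → HasInduced (star (1 + r)) (blowup Ŵ r)
Ŵ-star = blowup-star Ŵ 0F (λ _ → 2F) (λ { zero zero _ → refl }) refl (λ _ → refl) (λ _ _ → refl) (λ _ → refl)

-- Z is the house (square 0123, roof 4 on 0 and 1) with a pendant vertex 5 at 0, to be blown
-- up; the 2-switch 01, 23 ↦ 02, 13 turns it into Ẑ = K_{2,3} with the pendant vertex.
-- Blowing 5 up into a - 3 twins, Z avoids K_{1,a} while Ẑ contains it.
Z Ẑ : Graph 6
Z = fromEdges 6 ((0 , 1) ∷ (0 , 3) ∷ (0 , 4) ∷ (1 , 2) ∷ (1 , 4) ∷ (2 , 3) ∷ (0 , 5) ∷ [])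
Ẑ = fromEdges 6 ((0 , 2) ∷ (0 , 3) ∷ (0 , 4) ∷ (1 , 2) ∷ (1 , 3) ∷ (1 , 4) ∷ (0 , 5) ∷ [])

Z-sameDegSeq : ∀ r → SameDegSeq (blowup Z r) (blowup Ẑ r)
Z-sameDegSeq r = sameDegSeq-pointwise (blowup Z r) (blowup Ẑ r) (blowup-degrees Z Ẑ
  (from-yes (all? λ p → adj Z p 5F ≟ᵇ adj Ẑ p 5F)) (from-yes (all? λ p → deg Z p ℕₚ.≟ deg Ẑ p)) r)

-- Independent neighbourhoods in Z are rainbow for this 2-colouring.
Z-rainbow : Fin 6 → Fin 2
Z-rainbow = lookup (0F ∷ 0F ∷ 1F ∷ 1F ∷ 0F ∷ 0F ∷ [])

Z-noStar : ∀ r → ¬ HasInduced (star (3 + r)) (blowup Z r)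
Z-noStar r = blowup-noStar Z (3 + r) Z-rainbow (_↑ˡ r) (2 ↑ʳ_) (ℕₚ.n<1+n _)
  (λ {i} {j} → ↑ˡ-injective r i j) (λ {i} {j} → ↑ʳ-injective 2 i j) (from-yes (rainbow? Z Z-rainbow))
  (λ c p j _ _ _ _ → ↑ˡ≢↑ʳ 2 r (Z-rainbow p) j)

Z-colouring : Fin 6 → Fin 3
Z-colouring = lookup (0F ∷ 1F ∷ 0F ∷ 1F ∷ 2F ∷ 1F ∷ [])

Z-noK1+K : ∀ r b → 4 ≤ b → ¬ HasInduced (K1+K b) (blowup Z r)
Z-noK1+K r b 4≤b = noK1+K-byColouring (blowup Z r) b (Z-colouring ∘ collapse 5 r)
  (λ p q → from-yes (proper? Z Z-colouring) (collapse 5 r p) (collapse 5 r q)) 4≤b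

Ẑ-star : ∀ r → HasInduced (star (3 + r)) (blowup Ẑ r)
Ẑ-star = blowup-star Ẑ 0F leaves (from-yes (injective? leaves)) refl
  (from-yes (all? λ i → adj Ẑ 0F (inject₁ (leaves i)) ≟ᵇ true))
  (from-yes (all? λ i → all? λ j → adj Ẑ (inject₁ (leaves i)) (inject₁ (leaves j)) ≟ᵇ false))
  (from-yes (all? λ i → adj Ẑ (inject₁ (leaves i)) 5F ≟ᵇ false))
  where
  leaves : Fin 3 → Fin 5
  leaves = lookup (2F ∷ 3F ∷ 4F ∷ [])

-- P₅ = 4—0—2—1—3 and, after the 2-switch 04, 13 ↦ 01, 34, P̂₅ = K₃ + K₂.
P₅ P̂₅ : Graph 5
P₅ = fromEdges 5 ((0 , 2) ∷ (0 , 4) ∷ (1 , 2) ∷ (1 , 3) ∷ [])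
P̂₅ = fromEdges 5 ((0 , 1) ∷ (0 , 2) ∷ (1 , 2) ∷ (3 , 4) ∷ [])

-- C₄ + K₂ (cycle 0415, edge 23) and P₃ + K₃ (path 203, triangle 145).
C₄K₂ P₃K₃ : Graph 6
C₄K₂ = fromEdges 6 ((0 , 4) ∷ (0 , 5) ∷ (1 , 4) ∷ (1 , 5) ∷ (2 , 3) ∷ [])
P₃K₃ = fromEdges 6 ((0 , 2) ∷ (0 , 3) ∷ (1 , 4) ∷ (1 , 5) ∷ (4 , 5) ∷ [])

P₅-sameDegSeq : SameDegSeq P₅ P̂₅
P₅-sameDegSeq = sameDegSeq-pointwise P₅ P̂₅ (from-yes (all? λ u → deg P₅ u ℕₚ.≟ deg P̂₅ u))

-- K_1 + K_3 in P̂₅ = K₃ + K₂: a vertex of the K₂ and the triangle.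
P̂₅-K1+K3 : HasInduced (K1+K 3) P̂₅
P̂₅-K1+K3 = inducedVia (K1+K 3) P̂₅ f (from-yes (injective? f)) (from-yes (preserves? (K1+K 3) P̂₅ f))
  where
  f : Fin 4 → Fin 5
  f = lookup (3F ∷ 0F ∷ 1F ∷ 2F ∷ [])

C₄K₂-sameDegSeq : SameDegSeq C₄K₂ P₃K₃
C₄K₂-sameDegSeq = sameDegSeq-pointwise C₄K₂ P₃K₃ (from-yes (all? λ u → deg C₄K₂ u ℕₚ.≟ deg P₃K₃ u))

-- K_1 + K_3 in P₃K₃: the centre of the path and the triangle.
P₃K₃-K1+K3 : HasInduced (K1+K 3) P₃K₃
P₃K₃-K1+K3 = inducedVia (K1+K 3) P₃K₃ f (from-yes (injective? f)) (from-yes (preserves? (K1+K 3) P₃K₃ f))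
  where
  f : Fin 4 → Fin 6
  f = lookup (0F ∷ 1F ∷ 4F ∷ 5F ∷ [])

-- A vertex of Fin (a + a) is read as a side (left or right) and an index in Fin a.
Side : ℕ → Set
Side a = Fin a ⊎ Fin a

side : ∀ {a} → Side a → Bool
side (inj₁ _) = true
side (inj₂ _) = false

index : ∀ {a} → Side a → Fin a
index (inj₁ i) = i
index (inj₂ i) = i

side-index-injective : ∀ {a} (x y : Side a) → side x ≡ side y → index x ≡ index y → x ≡ y
side-index-injective (inj₁ i) (inj₁ j) _ i≡j = cong inj₁ i≡j
side-index-injective (inj₂ i) (inj₂ j) _ i≡j = cong inj₂ i≡j

twoSided : ∀ a (R : Side a → Side a → Bool) → (∀ x y → R x y ≡ R y x) → (∀ x → R x x ≡ false) →
  Graph (a + a)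
twoSided a R R-sym R-irrefl = record
  { adj    = λ u v → R (splitAt a u) (splitAt a v)
  ; sym    = λ u v → R-sym (splitAt a u) (splitAt a v)
  ; irrefl = λ u → R-irrefl (splitAt a u) }

deg-twoSided : ∀ a R R-sym R-irrefl u → let x = splitAt a u in
  deg (twoSided a R R-sym R-irrefl) u ≡ ∑ a (λ i → bit (R x (inj₁ i))) + ∑ a (λ j → bit (R x (inj₂ j)))
deg-twoSided a R R-sym R-irrefl u = trans (deg-∑ (twoSided a R R-sym R-irrefl) u) (trans (∑-split a a _) (cong₂ _+_
  (∑-cong a λ i → cong (λ y → bit (R (splitAt a u) y)) (splitAt-↑ˡ a i a))
  (∑-cong a λ j → cong (λ y → bit (R (splitAt a u) y)) (splitAt-↑ʳ a a j))))

-- The co-crown: each side is complete, and across the sides only i—i.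
crown : ∀ {a} → Side a → Side a → Bool
crown (inj₁ i) (inj₁ j) = not (does (i ≟ j))
crown (inj₂ i) (inj₂ j) = not (does (i ≟ j))
crown (inj₁ i) (inj₂ j) = does (i ≟ j)
crown (inj₂ i) (inj₁ j) = does (i ≟ j)

crown-sym : ∀ {a} (x y : Side a) → crown x y ≡ crown y x
crown-sym (inj₁ i) (inj₁ j) = cong not (does-sym i j)
crown-sym (inj₂ i) (inj₂ j) = cong not (does-sym i j)
crown-sym (inj₁ i) (inj₂ j) = does-sym i j
crown-sym (inj₂ i) (inj₁ j) = does-sym i j

crown-irrefl : ∀ {a} (x : Side a) → crown x x ≡ false
crown-irrefl (inj₁ i) = cong not (dec-true (i ≟ i) refl)
crown-irrefl (inj₂ i) = cong not (dec-true (i ≟ i) refl)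

coCrown : ∀ a → Graph (a + a)
coCrown a = twoSided a crown crown-sym crown-irrefl

across : ∀ {a} → Side a → Side a → Bool
across x y = not (does (side x ≟ᵇ side y))

across-sym : ∀ {a} (x y : Side a) → across x y ≡ across y x
across-sym (inj₁ _) (inj₁ _) = refl
across-sym (inj₁ _) (inj₂ _) = refl
across-sym (inj₂ _) (inj₁ _) = refl
across-sym (inj₂ _) (inj₂ _) = refl

across-irrefl : ∀ {a} (x : Side a) → across x x ≡ false
across-irrefl (inj₁ _) = refl
across-irrefl (inj₂ _) = refl

completeBipartite : ∀ a → Graph (a + a)
completeBipartite a = twoSided a across across-sym across-irrefl

-- Both graphs are a-regular, so they realize the same degree sequence.
coCrown-regular : ∀ a u → deg (coCrown a) u ≡ a
coCrown-regular a u = trans (deg-twoSided a crown crown-sym crown-irrefl u) (count (splitAt a u))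
  where
  count : ∀ x → ∑ a (λ i → bit (crown x (inj₁ i))) + ∑ a (λ j → bit (crown x (inj₂ j))) ≡ a
  count (inj₁ i) = ∑-not+bit a (λ j → does (i ≟ j))
  count (inj₂ i) = trans (ℕₚ.+-comm (∑ a _) _) (∑-not+bit a (λ j → does (i ≟ j)))

completeBipartite-regular : ∀ a u → deg (completeBipartite a) u ≡ a
completeBipartite-regular a u = trans (deg-twoSided a across across-sym across-irrefl u) (count (splitAt a u))
  where
  count : ∀ x → ∑ a (λ i → bit (across x (inj₁ i))) + ∑ a (λ j → bit (across x (inj₂ j))) ≡ a
  count (inj₁ _) = ∑-not+bit a (λ _ → true)
  count (inj₂ _) = trans (ℕₚ.+-comm (∑ a _) _) (∑-not+bit a (λ _ → true))

coCrown-sameDegSeq : ∀ a → SameDegSeq (coCrown a) (completeBipartite a)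
coCrown-sameDegSeq a = sameDegSeq-pointwise (coCrown a) (completeBipartite a)
  λ u → trans (coCrown-regular a u) (≡-sym (completeBipartite-regular a u))

completeBipartite-star : ∀ a (c : Fin a) → HasInduced (star a) (completeBipartite a)
completeBipartite-star a c = starAt (completeBipartite a) (c ↑ˡ a) (a ↑ʳ_) (λ {i} {j} → ↑ʳ-injective a i j)
  (λ j → cong₂ across (splitAt-↑ˡ a c a) (splitAt-↑ʳ a a j))
  (λ i j → cong₂ across (splitAt-↑ʳ a a i) (splitAt-↑ʳ a a j))

crown-nonadjacent : ∀ {a} (x y : Side a) → x ≢ y → crown x y ≡ false → side x ≢ side y × index x ≢ index y
crown-nonadjacent (inj₁ i) (inj₁ j) x≢y e = ⊥-elim (x≢y (cong inj₁ (does⇒≡ (not-injective e))))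
crown-nonadjacent (inj₂ i) (inj₂ j) x≢y e = ⊥-elim (x≢y (cong inj₂ (does⇒≡ (not-injective e))))
crown-nonadjacent (inj₁ i) (inj₂ j) _ e = (λ ()) , λ i≡j → true≢false (trans (≡-sym (dec-true (i ≟ j) i≡j)) e)
crown-nonadjacent (inj₂ i) (inj₁ j) _ e = (λ ()) , λ i≡j → true≢false (trans (≡-sym (dec-true (i ≟ j) i≡j)) e)

-- The co-crown has no independent set of three vertices (there are only two sides).
coCrown-noIndependentTriple : ∀ a (u v w : Fin (a + a)) → u ≢ v → v ≢ w → u ≢ w →
  adj (coCrown a) u v ≡ false → adj (coCrown a) v w ≡ false → adj (coCrown a) u w ≡ false → ⊥
coCrown-noIndependentTriple a u v w u≢v v≢w u≢w uv vw uw =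
  opposite u v u≢v uv (two-valued (opposite u w u≢w uw) (opposite v w v≢w vw))
  where
  opposite : ∀ x y → x ≢ y → adj (coCrown a) x y ≡ false → side (splitAt a x) ≢ side (splitAt a y)
  opposite x y x≢y = proj₁ ∘ crown-nonadjacent (splitAt a x) (splitAt a y) (x≢y ∘ splitAt-injective a x y)

-- Three leaves of a star would be an independent triple.
coCrown-noStar : ∀ a a′ → ¬ HasInduced (star (3 + a′)) (coCrown a)
coCrown-noStar a a′ (f , f-inj , pres) = coCrown-noIndependentTriple a (f 1F) (f 2F) (f 3F)
  (λ e → 1≢2 (f-inj e)) (λ e → 2≢3 (f-inj e)) (λ e → 1≢3 (f-inj e))
  (≡-sym (pres 1F 2F)) (≡-sym (pres 2F 3F)) (≡-sym (pres 1F 3F))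
  where
  1≢2 : 1F ≢ 2F
  1≢2 ()
  2≢3 : 2F ≢ 3F
  2≢3 ()
  1≢3 : 1F ≢ 3F
  1≢3 ()

-- Each vertex of the co-crown of order a has only a - 1 non-neighbours, all on the other side,
-- so K_1 + K_b with b ≥ a is not induced: indices would injectively map b + 1 vertices to a.
coCrown-noK1+K : ∀ a b → a ≤ b → ¬ HasInduced (K1+K b) (coCrown a)
coCrown-noK1+K a b a≤b (f , f-inj , pres)
  with i , j , i<j , same ← pigeonhole (s≤s a≤b) (index ∘ splitAt a ∘ f) = collision i j (<⇒≢ i<j) same
  where
  x : Fin (suc b) → Side a
  x = splitAt a ∘ f
  awayFromIsolated : ∀ j → side (x (suc j)) ≢ side (x zero) × index (x (suc j)) ≢ index (x zero)
  awayFromIsolated j = crown-nonadjacent (x (suc j)) (x zero)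
    (λ e → 0≢1+n (≡-sym (f-inj (splitAt-injective a _ _ e)))) (≡-sym (pres (suc j) zero))
  collision : ∀ i j → i ≢ j → index (x i) ≡ index (x j) → ⊥
  collision zero    zero    i≢j _    = i≢j refl
  collision zero    (suc j) _   same = proj₂ (awayFromIsolated j) (≡-sym same)
  collision (suc i) zero    _   same = proj₂ (awayFromIsolated i) same
  collision (suc i) (suc j) i≢j same = i≢j (f-inj (splitAt-injective a _ _
    (side-index-injective (x (suc i)) (x (suc j)) (two-valued (proj₁ (awayFromIsolated i)) (proj₁ (awayFromIsolated j))) same)))

-- Four vertices of an induced subgraph of the co-crown contain no independent triple, so
-- their shape avoids every set all of whose members have one.
coCrown-excludes : ∀ {m} a {X : Graph m} (S : Trie 6) → allMembers hasIndependentTriple S ≡ true →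
  HasInduced X (coCrown a) → (ι : Fin 4 → Fin m) → Injective _≡_ _≡_ ι → member (shape (adj X) ι) S ≢ true
coCrown-excludes a {X} S allIndependent (f , f-inj , pres) ι ι-inj inS =
  true≢false (trans (≡-sym (allMembers-sound hasIndependentTriple (shape (adj X) ι) S allIndependent inS))
    (∨-false (triple 0F 1F 2F (λ ()) (λ ()) (λ ())) (∨-false (triple 0F 1F 3F (λ ()) (λ ()) (λ ()))
      (∨-false (triple 0F 2F 3F (λ ()) (λ ()) (λ ())) (triple 1F 2F 3F (λ ()) (λ ()) (λ ()))))))
  where
  A : Fin 4 → Fin 4 → Bool
  A i j = adj X (ι i) (ι j)
  distinct : ∀ {i j} → i ≢ j → f (ι i) ≢ f (ι j)
  distinct i≢j e = i≢j (ι-inj (f-inj e))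
  triple : ∀ i j l → i ≢ j → j ≢ l → i ≢ l → noneOf (A i j) (A i l) (A j l) ≡ false
  triple i j l i≢j j≢l i≢l = noneOf-false _ _ _ λ ij il jl →
    coCrown-noIndependentTriple a (f (ι i)) (f (ι j)) (f (ι l)) (distinct i≢j) (distinct j≢l) (distinct i≢l)
      (trans (≡-sym (pres _ _)) ij) (trans (≡-sym (pres _ _)) jl) (trans (≡-sym (pres _ _)) il)

forced : ∀ {a b m n} (F : Graph m) → DSF (Fam a b F) → (G H : Graph n) → SameDegSeq G H →
  ¬ HasInduced (star a) G → ¬ HasInduced (K1+K b) G → HasInduced (star a) H ⊎ HasInduced (K1+K b) H →
  ¬ ¬ HasInduced F G
forced F dsf G H same noStar noK witness noF with dsf G H same (noStar ∷ noK ∷ noF ∷ [])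
... | H-noStar ∷ H-noK ∷ _ = [ H-noStar , H-noK ] witness

-- Case 3 ≤ a ≤ b with 4 ≤ b, writing a = 3 + a′: F is forced into W with a - 1 twins, Z with
-- a - 3 twins and the co-crown of order a, which have no common four-vertex shape.
notDSF-b≥4 : ∀ {a′ b m} (F : Graph m) → 4 ≤ m → 3 + a′ ≤ b → 4 ≤ b → ¬ DSF (Fam (3 + a′) b F)
notDSF-b≥4 {a′} {b} F 4≤m a≤b 4≤b dsf =
  forced F dsf (blowup W (2 + a′)) (blowup Ŵ (2 + a′)) (W-sameDegSeq _) (W-noStar a′) (W-noK1+K _ b 4≤b)
    (inj₁ (Ŵ-star _)) λ F⊑W →
  forced F dsf (blowup Z a′) (blowup Ẑ a′) (Z-sameDegSeq a′) (Z-noStar a′) (Z-noK1+K a′ b 4≤b)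
    (inj₁ (Ẑ-star a′)) λ F⊑Z →
  forced F dsf (coCrown a) (completeBipartite a) (coCrown-sameDegSeq a) (coCrown-noStar a a′)
    (coCrown-noK1+K a b a≤b) (inj₁ (completeBipartite-star a zero)) λ F⊑C →
  coCrown-excludes a {F} (shapes W isLast ∩ shapes Z isLast) refl F⊑C ι ι-inj
    (member-∩ s (shapes W isLast) (shapes Z isLast)
      (shape-blowup W (2 + a′) {F} F⊑W ι ι-inj) (shape-blowup Z a′ {F} F⊑Z ι ι-inj))
  where
  a = 3 + a′
  ι = firstFour 4≤m
  ι-inj = firstFour-injective 4≤m
  s = shape (adj F) ι

-- Case a = b = 3: F is forced into the house, the co-crown of order 3, P₅ and C₄ + K₂, which
-- have no common four-vertex shape.
notDSF-3-3 : ∀ {m} (F : Graph m) → 4 ≤ m → ¬ DSF (Fam 3 3 F)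
notDSF-3-3 F 4≤m dsf =
  forced F dsf (blowup Z 0) (blowup Ẑ 0) (Z-sameDegSeq 0) (Z-noStar 0) (absent-blowup Z 0 (K1+K 3) refl)
    (inj₁ (Ẑ-star 0)) λ F⊑Z →
  forced F dsf (coCrown 3) (completeBipartite 3) (coCrown-sameDegSeq 3) (coCrown-noStar 3 0)
    (coCrown-noK1+K 3 3 ℕₚ.≤-refl) (inj₁ (completeBipartite-star 3 zero)) λ F⊑C →
  forced F dsf P₅ P̂₅ P₅-sameDegSeq (absent-plain P₅ (star 3) refl) (absent-plain P₅ (K1+K 3) refl)
    (inj₂ P̂₅-K1+K3) λ F⊑P →
  forced F dsf C₄K₂ P₃K₃ C₄K₂-sameDegSeq (absent-plain C₄K₂ (star 3) refl) (absent-plain C₄K₂ (K1+K 3) refl)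
    (inj₂ P₃K₃-K1+K3) λ F⊑C₄ →
  coCrown-excludes 3 {F} (shapes Z isLast ∩ (shapes P₅ unmarked ∩ shapes C₄K₂ unmarked)) refl F⊑C ι ι-inj
    (member-∩ s (shapes Z isLast) (shapes P₅ unmarked ∩ shapes C₄K₂ unmarked) (shape-blowup Z 0 {F} F⊑Z ι ι-inj)
      (member-∩ s (shapes P₅ unmarked) (shapes C₄K₂ unmarked)
        (shape-plain P₅ {F} F⊑P ι ι-inj) (shape-plain C₄K₂ {F} F⊑C₄ ι ι-inj)))
  where
  ι = firstFour 4≤m
  ι-inj = firstFour-injective 4≤m
  s = shape (adj F) ι

notDSF-ordered : ∀ {a b m} (F : Graph m) → 4 ≤ m → 3 ≤ a → a ≤ b → ¬ DSF (Fam a b F)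
notDSF-ordered F 4≤m (s≤s (s≤s (s≤s _))) (s≤s (s≤s (s≤s {n = zero} z≤n))) = notDSF-3-3 F 4≤m
notDSF-ordered F 4≤m (s≤s (s≤s (s≤s _))) a≤b@(s≤s (s≤s (s≤s {n = suc _} _))) =
  notDSF-b≥4 F 4≤m a≤b (s≤s (s≤s (s≤s (s≤s z≤n))))

lemma3p8 : (a₂ b₂ : ℕ) → 3 ≤ a₂ → 3 ≤ b₂ →
    (m : ℕ) (F₃ : Graph m) → 4 ≤ m →
    ¬ DSF ((_ , star a₂) ∷ (_ , K1+K b₂) ∷ (m , F₃) ∷ [])
lemma3p8 a₂ b₂ 3≤a 3≤b m F₃ 4≤m with ℕₚ.≤-total a₂ b₂
... | inj₁ a≤b = notDSF-ordered F₃ 4≤m 3≤a a≤b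
... | inj₂ b≤a = notDSF-ordered (comp F₃) 4≤m 3≤b b≤a ∘ DSF-dual F₃
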